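{- Let $p$ be an odd prime, and let $C_n=\binom{2n}n\frac1{n+1}$ be the Catalan numbers. Then $$\sum_{k=0}^{(p-1)/2}(4k+3)\frac{C_k^4}{256^k}\equiv16\pmod{p^4}.$$
   Context: Congruences are in the ring of rationals with denominators prime to $p$. -}

module Defs where

open import Data.Nat as ℕ using (ℕ; zero; suc)
import Data.Nat.Properties as Nat
open import Data.Nat.Combinatorics using (_C_)
open import Data.Nat.Divisibility using (_∣_)
open import Data.Integer as ℤ using (ℤ; +_)
open import Data.Rational as ℚ using (ℚ; _/_; _+_; _-_; _*_; _÷_)
open import Data.Product using (Σ; _×_)
open import Relation.Nullary using (¬_)
open import Relation.Binary.PropositionalEquality using (_≡_)

ℕ→ℚ : ℕ → ℚ
ℕ→ℚ n = (+ n) / 1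

catalan : ℕ → ℚ
catalan n = ((+ ((2 ℕ.* n) C n)) / suc n)

term : ℕ → ℚ
term k = ℕ→ℚ (4 ℕ.* k ℕ.+ 3) * (c * c * c * c) * ((+ 1) / (256 ℕ.^ k)) {{Nat.m^n≢0 256 k}}
  where
  c = catalan k

sumTo : ℕ → ℚ
sumTo zero = term zero
sumTo (suc n) = sumTo n + term (suc n)

-- x ≡ y (mod p^e) in the ring of rationals with denominators prime to p:
-- x - y = p^e * a / b with a ∈ ℤ, b ∈ ℕ, p ∤ b.
CongPow : ℕ → ℕ → ℚ → ℚ → Set
CongPow p e x y =
  Σ ℤ λ a → Σ ℕ λ b → (¬ (p ∣ b)) × (ℕ→ℚ b * (x - y) ≡ (+ (p ℕ.^ e)) / 1 * (a / 1))

{-# OPTIONS --safe #-}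
module Submission where

open import Defs
open import Data.Nat using (ℕ; _∸_; _/_)
open import Data.Nat.Primality using (Prime)
open import Data.Rational using (ℚ)
open import Relation.Binary.PropositionalEquality using (_≡_)
open import Relation.Nullary using (¬_)

-- The partial sums telescope: writing B m = C(2m, m) and P n = 8n² + 20n + 13,
--   Σ_{k ≤ n} (4k + 3) C_k⁴ / 256^k  =  16 − P n · B (n + 1)⁴ / (16 · 256ⁿ).
-- In the induction step C_{n+1} = B (n + 1) / (n + 2) and B (n + 2) = 2(2n + 3) C_{n+1}
-- express everything through C_{n+1}, leaving the polynomial identity
--   16 (4n + 7) + P (n + 1) (2(2n + 3))⁴ = 256 P n (n + 2)⁴.
-- For a prime p = 2n + 1 we have n + 1 < p ≤ 2n + 2, so p divides (2n + 2)! but not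
-- (n + 1)!², hence p ∣ B (n + 1) and the remainder is p⁴ times an integer over a power of 2.

open import Data.Nat as ℕ using (zero; suc; NonZero)
import Data.Nat.Properties as ℕ
open import Data.Nat.Divisibility using (_∣_; divides; ∣1⇒≡1)
open import Data.Nat.DivMod using (m*n/n≡m)
open import Data.Nat.Primality using (euclidsLemma; ¬prime[1])
open import Data.Nat.Tactic.RingSolver using (solve-∀)
open import Data.Product using (∃-syntax; _,_)
open import Data.Sum using (_⊎_; inj₁; inj₂)
open import Data.Empty using (⊥-elim)
open import Relation.Binary.PropositionalEquality
  using (refl; sym; trans; cong; cong₂; subst; module ≡-Reasoning)

module Primes where

  open import Data.Nat using (_+_; _*_; _^_; _!; _≤_)
  open import Data.Nat.Divisibility using (∣⇒≤)
  open import Data.Nat.Primality using (prime⇒irreducible; irreducible[2])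

  prime∤1 : ∀ {p} → Prime p → ¬ (p ∣ 1)
  prime∤1 pp p∣1 = ¬prime[1] (subst Prime (∣1⇒≡1 p∣1) pp)

  prime∤* : ∀ {p m n} → Prime p → ¬ (p ∣ m) → ¬ (p ∣ n) → ¬ (p ∣ m * n)
  prime∤* {m = m} {n} pp p∤m p∤n p∣m*n with euclidsLemma m n pp p∣m*n
  ... | inj₁ p∣m = p∤m p∣m
  ... | inj₂ p∣n = p∤n p∣n

  prime∤^ : ∀ {p m} → Prime p → ¬ (p ∣ m) → ∀ k → ¬ (p ∣ m ^ k)
  prime∤^ pp p∤m zero    = prime∤1 pp
  prime∤^ pp p∤m (suc k) = prime∤* pp p∤m (prime∤^ pp p∤m k)

  prime∣m!⇒p≤m : ∀ {p} → Prime p → ∀ m → p ∣ m ! → p ≤ m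
  prime∣m!⇒p≤m pp zero    p∣1 = ⊥-elim (prime∤1 pp p∣1)
  prime∣m!⇒p≤m pp (suc m) p∣[1+m]! with euclidsLemma (suc m) (m !) pp p∣[1+m]!
  ... | inj₁ p∣1+m = ∣⇒≤ p∣1+m
  ... | inj₂ p∣m!  = ℕ.m≤n⇒m≤1+n (prime∣m!⇒p≤m pp m p∣m!)

  odd-prime∤2 : ∀ {p} → Prime p → ¬ (p ≡ 2) → ¬ (p ∣ 2)
  odd-prime∤2 pp p≢2 p∣2 with irreducible[2] p∣2
  ... | inj₁ p≡1 = ¬prime[1] (subst Prime p≡1 pp)
  ... | inj₂ p≡2 = p≢2 p≡2

  odd-prime∤16*256^n : ∀ {p} → Prime p → ¬ (p ≡ 2) → ∀ n → ¬ (p ∣ 16 * 256 ^ n)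
  odd-prime∤16*256^n pp p≢2 n = prime∤* pp (p∤2^ 4) (prime∤^ pp (p∤2^ 8) n)
    where p∤2^ = prime∤^ pp (odd-prime∤2 pp p≢2)

  even⊎odd : ∀ n → (∃[ q ] n ≡ 2 * q) ⊎ (∃[ q ] n ≡ 1 + 2 * q)
  even⊎odd zero = inj₁ (0 , refl)
  even⊎odd (suc n) with even⊎odd n
  ... | inj₁ (q , n≡2q)   = inj₂ (q , cong suc n≡2q)
  ... | inj₂ (q , n≡1+2q) = inj₁ (suc q , trans (cong suc n≡1+2q) (sym (ℕ.*-distribˡ-+ 2 1 q)))

  odd-prime≡1+2n : ∀ {p} → Prime p → ¬ (p ≡ 2) → ∃[ n ] p ≡ 1 + 2 * n
  odd-prime≡1+2n {p} pp p≢2 with even⊎odd p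
  ... | inj₂ odd = odd
  ... | inj₁ (q , p≡2q) with prime⇒irreducible pp (divides q (trans p≡2q (ℕ.*-comm 2 q)))
  ...   | inj₁ ()
  ...   | inj₂ 2≡p = ⊥-elim (p≢2 (sym 2≡p))

open Primes

module CentralBinomial where

  open import Data.Nat using (_+_; _*_; _!; _≤_; _<_; s≤s)
  open import Data.Nat.Combinatorics using (_C_; nCk≡n!/k![n-k]!; k![n∸k]!∣n!)
  open import Data.Nat.Divisibility using (∣-trans; m≤n⇒m!∣n!; m∣m*n)
  open import Data.Nat.DivMod using (m/n*n≡m)

  centralBinomial : ℕ → ℕ
  centralBinomial m = (2 * m) C m

  nCk*k![n∸k]!≡n! : ∀ {n k} → k ≤ n → (n C k) * (k ! * (n ∸ k) !) ≡ n !
  nCk*k![n∸k]!≡n! {n} {k} k≤n = trans (cong (_* (k ! * (n ∸ k) !)) (nCk≡n!/k![n-k]! k≤n))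
                                      (m/n*n≡m {{ℕ._!*_!≢0 k (n ∸ k)}} (k![n∸k]!∣n! k≤n))

  centralBinomial*m!*m!≡[2m]! : ∀ m → centralBinomial m * (m ! * m !) ≡ (2 * m) !
  centralBinomial*m!*m!≡[2m]! m =
    subst (λ k → centralBinomial m * (m ! * k !) ≡ (2 * m) !) 2m∸m≡m (nCk*k![n∸k]!≡n! m≤2m)
    where
    m≤2m : m ≤ 2 * m
    m≤2m = ℕ.m≤m+n m (m + 0)
    2m∸m≡m : 2 * m ∸ m ≡ m
    2m∸m≡m = trans (ℕ.m+n∸m≡n m (m + 0)) (ℕ.+-identityʳ m)

  [1+m]*centralBinomial[1+m] : ∀ m →
    suc m * centralBinomial (suc m) ≡ 2 * (2 * m + 1) * centralBinomial m
  [1+m]*centralBinomial[1+m] m =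
    ℕ.*-cancelʳ-≡ _ _ (suc m * (m ! * m !)) {{ℕ.m*n≢0 (suc m) _ {{_}} {{ℕ._!*_!≢0 m m}}}} (begin
      suc m * X * (suc m * (m ! * m !))               ≡⟨ square-out m X (m !) ⟩
      X * (suc m ! * suc m !)                         ≡⟨ centralBinomial*m!*m!≡[2m]! (suc m) ⟩
      (2 * suc m) !                                   ≡⟨ cong _! (ℕ.*-distribˡ-+ 2 1 m) ⟩
      (2 + 2 * m) * ((1 + 2 * m) * (2 * m) !)         ≡⟨ cong (λ k → (2 + 2 * m) * ((1 + 2 * m) * k))
                                                              (centralBinomial*m!*m!≡[2m]! m) ⟨
      (2 + 2 * m) * ((1 + 2 * m) * (Y * (m ! * m !))) ≡⟨ regroup m Y (m ! * m !) ⟩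
      2 * (2 * m + 1) * Y * (suc m * (m ! * m !))     ∎)
    where
    open ≡-Reasoning
    X = centralBinomial (suc m)
    Y = centralBinomial m
    square-out : ∀ m x f → suc m * x * (suc m * (f * f)) ≡ x * (suc m * f * (suc m * f))
    square-out = solve-∀
    regroup : ∀ m y g → (2 + 2 * m) * ((1 + 2 * m) * (y * g)) ≡ 2 * (2 * m + 1) * y * (suc m * g)
    regroup = solve-∀

  prime∣centralBinomial : ∀ {p m} → Prime p → m < p → p ≤ 2 * m → p ∣ centralBinomial m
  prime∣centralBinomial {p@(suc p-1)} {m} pp m<p p≤2m
    with euclidsLemma (centralBinomial m) (m ! * m !) pp p∣C*m!*m!
    where
    p∣C*m!*m! : p ∣ centralBinomial m * (m ! * m !)
    p∣C*m!*m! = subst (p ∣_) (sym (centralBinomial*m!*m!≡[2m]! m))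
                  (∣-trans (m∣m*n (p-1 !)) (m≤n⇒m!∣n! p≤2m))
  ... | inj₁ p∣C = p∣C
  ... | inj₂ p∣m!*m! with euclidsLemma (m !) (m !) pp p∣m!*m!
  ...   | inj₁ p∣m! = ⊥-elim (ℕ.<⇒≱ m<p (prime∣m!⇒p≤m pp m p∣m!))
  ...   | inj₂ p∣m! = ⊥-elim (ℕ.<⇒≱ m<p (prime∣m!⇒p≤m pp m p∣m!))

  prime[1+2n]∣centralBinomial[1+n] : ∀ {n} → Prime (1 + 2 * n) → 1 + 2 * n ∣ centralBinomial (suc n)
  prime[1+2n]∣centralBinomial[1+n] {zero}  pp = ⊥-elim (¬prime[1] pp)
  prime[1+2n]∣centralBinomial[1+n] {suc k} pp = prime∣centralBinomial pp
    (s≤s (ℕ.m<m+n (suc k) ℕ.0<1+n))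
    (subst (1 + 2 * suc k ≤_) (sym (ℕ.*-distribˡ-+ 2 1 (suc k))) (ℕ.n≤1+n _))

open CentralBinomial

module RemainderPolynomial where

  open import Data.Nat using (_+_; _*_)

  remainderPolynomial : ℕ → ℕ
  remainderPolynomial n = 8 * n * n + 20 * n + 13

  -- Stated with remainderPolynomial unfolded, since solve-∀ treats defined names as opaque.
  remainderPolynomial-step : ∀ n → let k = 2 * (2 * suc n + 1); m = 2 + n in
    16 * (4 * suc n + 3) + (8 * suc n * suc n + 20 * suc n + 13) * (k * k * k * k)
      ≡ 256 * (8 * n * n + 20 * n + 13) * (m * m * m * m)
  remainderPolynomial-step = solve-∀

open RemainderPolynomial

open import Data.Integer as ℤ using (ℤ; +_)
import Data.Integer.Properties as ℤ
open import Data.Rational as ℚ using (_+_; _*_; _-_; -_; 1ℚ; toℚᵘ)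
open import Data.Rational.Properties
  using (toℚᵘ-injective; toℚᵘ-fromℚᵘ; toℚᵘ-homo-*; toℚᵘ-homo-+; toℚᵘ-homo‿-;
         *-assoc; *-identityˡ; *-identityʳ; +-assoc)
open import Data.Rational.Unnormalised as ℚᵘ using (mkℚᵘ; *≡*) renaming (_≃_ to _≃ᵘ_)
import Data.Rational.Unnormalised.Properties as ℚᵘ
open import Data.Rational.Solver using (module +-*-Solver)

ℤ→ℚ : ℤ → ℚ
ℤ→ℚ i = i ℚ./ 1

toℚᵘ-/ : ∀ i d → toℚᵘ (i ℚ./ suc d) ≃ᵘ mkℚᵘ i d
toℚᵘ-/ i d = toℚᵘ-fromℚᵘ (mkℚᵘ i d)

ℤ→ℚ-homo-+ : ∀ i j → ℤ→ℚ (i ℤ.+ j) ≡ ℤ→ℚ i + ℤ→ℚ j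
ℤ→ℚ-homo-+ i j = toℚᵘ-injective (begin
  toℚᵘ (ℤ→ℚ (i ℤ.+ j))             ≈⟨ toℚᵘ-/ (i ℤ.+ j) 0 ⟩
  mkℚᵘ (i ℤ.+ j) 0                 ≡⟨ cong₂ (λ a b → mkℚᵘ (a ℤ.+ b) 0)
                                             (ℤ.*-identityʳ i) (ℤ.*-identityʳ j) ⟨
  mkℚᵘ i 0 ℚᵘ.+ mkℚᵘ j 0           ≈⟨ ℚᵘ.+-cong (toℚᵘ-/ i 0) (toℚᵘ-/ j 0) ⟨
  toℚᵘ (ℤ→ℚ i) ℚᵘ.+ toℚᵘ (ℤ→ℚ j)   ≈⟨ toℚᵘ-homo-+ (ℤ→ℚ i) (ℤ→ℚ j) ⟨
  toℚᵘ (ℤ→ℚ i + ℤ→ℚ j)             ∎)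
  where open ℚᵘ.≃-Reasoning

ℤ→ℚ-homo-* : ∀ i j → ℤ→ℚ (i ℤ.* j) ≡ ℤ→ℚ i * ℤ→ℚ j
ℤ→ℚ-homo-* i j = toℚᵘ-injective (begin
  toℚᵘ (ℤ→ℚ (i ℤ.* j))             ≈⟨ toℚᵘ-/ (i ℤ.* j) 0 ⟩
  mkℚᵘ i 0 ℚᵘ.* mkℚᵘ j 0           ≈⟨ ℚᵘ.*-cong (toℚᵘ-/ i 0) (toℚᵘ-/ j 0) ⟨
  toℚᵘ (ℤ→ℚ i) ℚᵘ.* toℚᵘ (ℤ→ℚ j)   ≈⟨ toℚᵘ-homo-* (ℤ→ℚ i) (ℤ→ℚ j) ⟨
  toℚᵘ (ℤ→ℚ i * ℤ→ℚ j)             ∎)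
  where open ℚᵘ.≃-Reasoning

ℤ→ℚ-homo‿- : ∀ i → ℤ→ℚ (ℤ.- i) ≡ - ℤ→ℚ i
ℤ→ℚ-homo‿- i = toℚᵘ-injective (begin
  toℚᵘ (ℤ→ℚ (ℤ.- i))   ≈⟨ toℚᵘ-/ (ℤ.- i) 0 ⟩
  ℚᵘ.- mkℚᵘ i 0        ≈⟨ ℚᵘ.-‿cong (toℚᵘ-/ i 0) ⟨
  ℚᵘ.- toℚᵘ (ℤ→ℚ i)    ≈⟨ toℚᵘ-homo‿- (ℤ→ℚ i) ⟨
  toℚᵘ (- ℤ→ℚ i)       ∎)
  where open ℚᵘ.≃-Reasoning

ℕ→ℚ-homo-+ : ∀ m n → ℕ→ℚ (m ℕ.+ n) ≡ ℕ→ℚ m + ℕ→ℚ n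
ℕ→ℚ-homo-+ m n = trans (cong ℤ→ℚ (ℤ.pos-+ m n)) (ℤ→ℚ-homo-+ (+ m) (+ n))

ℕ→ℚ-homo-* : ∀ m n → ℕ→ℚ (m ℕ.* n) ≡ ℕ→ℚ m * ℕ→ℚ n
ℕ→ℚ-homo-* m n = trans (cong ℤ→ℚ (ℤ.pos-* m n)) (ℤ→ℚ-homo-* (+ m) (+ n))

ℕ→ℚ-homo-*-fourth : ∀ a b →
  ℕ→ℚ (a ℕ.* (b ℕ.* b ℕ.* b ℕ.* b)) ≡ ℕ→ℚ a * (ℕ→ℚ b * ℕ→ℚ b * ℕ→ℚ b * ℕ→ℚ b)
ℕ→ℚ-homo-*-fourth a b = trans (ℕ→ℚ-homo-* a (b ℕ.* b ℕ.* b ℕ.* b)) (cong (ℕ→ℚ a *_)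
  (trans (ℕ→ℚ-homo-* (b ℕ.* b ℕ.* b) b) (cong (_* ℕ→ℚ b)
    (trans (ℕ→ℚ-homo-* (b ℕ.* b) b) (cong (_* ℕ→ℚ b) (ℕ→ℚ-homo-* b b))))))

i/n*n≡i : ∀ i n .{{_ : NonZero n}} → i ℚ./ n * ℕ→ℚ n ≡ ℤ→ℚ i
i/n*n≡i i (suc d) = toℚᵘ-injective (begin
  toℚᵘ (i ℚ./ suc d * ℕ→ℚ (suc d))            ≈⟨ toℚᵘ-homo-* (i ℚ./ suc d) (ℕ→ℚ (suc d)) ⟩
  toℚᵘ (i ℚ./ suc d) ℚᵘ.* toℚᵘ (ℕ→ℚ (suc d))  ≈⟨ ℚᵘ.*-cong (toℚᵘ-/ i d) (toℚᵘ-/ (+ suc d) 0) ⟩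
  mkℚᵘ i d ℚᵘ.* mkℚᵘ (+ suc d) 0              ≈⟨ *≡* (trans (ℤ.*-identityʳ (i ℤ.* + suc d))
                                                   (cong (λ k → i ℤ.* + suc k) (sym (ℕ.*-identityʳ d)))) ⟩
  mkℚᵘ i 0                                    ≈⟨ toℚᵘ-/ i 0 ⟨
  toℚᵘ (ℤ→ℚ i)                                ∎)
  where open ℚᵘ.≃-Reasoning

1/[m*n]≡1/m*1/n : ∀ m n .{{_ : NonZero m}} .{{_ : NonZero n}} →
                  ((+ 1) ℚ./ (m ℕ.* n)) {{ℕ.m*n≢0 m n}} ≡ (+ 1) ℚ./ m * ((+ 1) ℚ./ n)
1/[m*n]≡1/m*1/n (suc m) (suc n) = toℚᵘ-injective (begin
  toℚᵘ ((+ 1) ℚ./ (suc m ℕ.* suc n))                 ≈⟨ toℚᵘ-/ (+ 1) (n ℕ.+ m ℕ.* suc n) ⟩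
  mkℚᵘ (+ 1) m ℚᵘ.* mkℚᵘ (+ 1) n                     ≈⟨ ℚᵘ.*-cong (toℚᵘ-/ (+ 1) m) (toℚᵘ-/ (+ 1) n) ⟨
  toℚᵘ ((+ 1) ℚ./ suc m) ℚᵘ.* toℚᵘ ((+ 1) ℚ./ suc n) ≈⟨ toℚᵘ-homo-* ((+ 1) ℚ./ suc m) ((+ 1) ℚ./ suc n) ⟨
  toℚᵘ ((+ 1) ℚ./ suc m * ((+ 1) ℚ./ suc n))         ∎)
  where open ℚᵘ.≃-Reasoning

ℕ→ℚ[1+m]-*-cancelˡ : ∀ m {x y} → ℕ→ℚ (suc m) * x ≡ ℕ→ℚ (suc m) * y → x ≡ y
ℕ→ℚ[1+m]-*-cancelˡ m {x} {y} M*x≡M*y = begin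
  x             ≡⟨ *-identityˡ x ⟨
  1ℚ * x        ≡⟨ cong (_* x) (i/n*n≡i (+ 1) (suc m)) ⟨
  w * M * x     ≡⟨ *-assoc w M x ⟩
  w * (M * x)   ≡⟨ cong (w *_) M*x≡M*y ⟩
  w * (M * y)   ≡⟨ *-assoc w M y ⟨
  w * M * y     ≡⟨ cong (_* y) (i/n*n≡i (+ 1) (suc m)) ⟩
  1ℚ * y        ≡⟨ *-identityˡ y ⟩
  y             ∎
  where
  open ≡-Reasoning
  M = ℕ→ℚ (suc m)
  w = (+ 1) ℚ./ suc m

CongPow-intro : ∀ {p e b} .{{_ : NonZero b}} → ¬ (p ∣ b) → ∀ {x y} a →
                x + ℕ→ℚ (p ℕ.^ e ℕ.* a) * ((+ 1) ℚ./ b) ≡ y → CongPow p e x y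
CongPow-intro {p} {e} {b} p∤b {x} {y} a x+r≡y = ℤ.- (+ a) , b , p∤b , (begin
  ℕ→ℚ b * (x - y)                             ≡⟨ cong (λ z → ℕ→ℚ b * (x - z)) x+r≡y ⟨
  ℕ→ℚ b * (x - (x + ℕ→ℚ (p ℕ.^ e ℕ.* a) * w)) ≡⟨ cong (λ z → ℕ→ℚ b * (x - (x + z * w)))
                                                      (ℕ→ℚ-homo-* (p ℕ.^ e) a) ⟩
  ℕ→ℚ b * (x - (x + P * A * w))               ≡⟨ cancel-x (ℕ→ℚ b) x P A w ⟩
  P * - A * (w * ℕ→ℚ b)                       ≡⟨ cong (λ z → P * - A * z) (i/n*n≡i (+ 1) b) ⟩
  P * - A * 1ℚ                                ≡⟨ *-identityʳ (P * - A) ⟩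
  P * - A                                     ≡⟨ cong (P *_) (ℤ→ℚ-homo‿- (+ a)) ⟨
  ℕ→ℚ (p ℕ.^ e) * ℤ→ℚ (ℤ.- (+ a))             ∎)
  where
  open ≡-Reasoning
  P = ℕ→ℚ (p ℕ.^ e)
  A = ℕ→ℚ a
  w = (+ 1) ℚ./ b
  cancel-x : ∀ β x P A w → β * (x - (x + P * A * w)) ≡ P * - A * (w * β)
  cancel-x = solve 5 (λ β x P A w → β :* (x :- (x :+ P :* A :* w)) := P :* (:- A) :* (w :* β)) refl
    where open +-*-Solver

centralBinomial≡catalan*[1+m] : ∀ m → ℕ→ℚ (centralBinomial m) ≡ catalan m * ℕ→ℚ (suc m)
centralBinomial≡catalan*[1+m] m = sym (i/n*n≡i (+ centralBinomial m) (suc m))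

centralBinomial[1+m]≡[4m+2]*catalan : ∀ m →
  ℕ→ℚ (centralBinomial (suc m)) ≡ ℕ→ℚ (2 ℕ.* (2 ℕ.* m ℕ.+ 1)) * catalan m
centralBinomial[1+m]≡[4m+2]*catalan m = ℕ→ℚ[1+m]-*-cancelˡ m (begin
  ℕ→ℚ (suc m) * ℕ→ℚ (centralBinomial (suc m)) ≡⟨ ℕ→ℚ-homo-* (suc m) (centralBinomial (suc m)) ⟨
  ℕ→ℚ (suc m ℕ.* centralBinomial (suc m))      ≡⟨ cong ℕ→ℚ ([1+m]*centralBinomial[1+m] m) ⟩
  ℕ→ℚ (k ℕ.* centralBinomial m)                ≡⟨ ℕ→ℚ-homo-* k (centralBinomial m) ⟩
  ℕ→ℚ k * ℕ→ℚ (centralBinomial m)              ≡⟨ cong (ℕ→ℚ k *_) (centralBinomial≡catalan*[1+m] m) ⟩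
  ℕ→ℚ k * (catalan m * ℕ→ℚ (suc m))            ≡⟨ rotate (ℕ→ℚ k) (catalan m) (ℕ→ℚ (suc m)) ⟩
  ℕ→ℚ (suc m) * (ℕ→ℚ k * catalan m)            ∎)
  where
  open ≡-Reasoning
  k = 2 ℕ.* (2 ℕ.* m ℕ.+ 1)
  rotate : ∀ x y z → x * (y * z) ≡ z * (x * y)
  rotate = solve 3 (λ x y z → x :* (y :* z) := z :* (x :* y)) refl
    where open +-*-Solver

16*256^n≢0 : ∀ n → NonZero (16 ℕ.* 256 ℕ.^ n)
16*256^n≢0 n = ℕ.m*n≢0 16 (256 ℕ.^ n) {{_}} {{ℕ.m^n≢0 256 n}}

remainder : ℕ → ℚ
remainder n = ℕ→ℚ (remainderPolynomial n ℕ.* (b ℕ.* b ℕ.* b ℕ.* b))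
            * ((+ 1) ℚ./ (16 ℕ.* 256 ℕ.^ n)) {{16*256^n≢0 n}}
  where b = centralBinomial (suc n)

remainder-step-algebra : ∀ (a b k r m : ℕ) (c e : ℚ) →
  16 ℕ.* a ℕ.+ b ℕ.* (k ℕ.* k ℕ.* k ℕ.* k) ≡ 256 ℕ.* r ℕ.* (m ℕ.* m ℕ.* m ℕ.* m) →
  let A = ℕ→ℚ a; B = ℕ→ℚ b; K = ℕ→ℚ k; R = ℕ→ℚ r; M = ℕ→ℚ m
      u = (+ 1) ℚ./ 256; v = (+ 1) ℚ./ 16 in
  A * (c * c * c * c) * (u * e) + B * ((K * c) * (K * c) * (K * c) * (K * c)) * (v * (u * e))
    ≡ R * ((c * M) * (c * M) * (c * M) * (c * M)) * (v * e)
remainder-step-algebra a b k r m c e coefficients = begin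
  A * (c * c * c * c) * (u * e) + B * ((K * c) * (K * c) * (K * c) * (K * c)) * (v * (u * e))
    ≡⟨ factor A B K c e ⟩
  (ℕ→ℚ 16 * A + B * (K * K * K * K)) * C
    ≡⟨ cong (_* C) (cong₂ _+_ (ℕ→ℚ-homo-* 16 a) (ℕ→ℚ-homo-*-fourth b k)) ⟨
  (ℕ→ℚ (16 ℕ.* a) + ℕ→ℚ (b ℕ.* (k ℕ.* k ℕ.* k ℕ.* k))) * C
    ≡⟨ cong (_* C) (ℕ→ℚ-homo-+ (16 ℕ.* a) (b ℕ.* (k ℕ.* k ℕ.* k ℕ.* k))) ⟨
  ℕ→ℚ (16 ℕ.* a ℕ.+ b ℕ.* (k ℕ.* k ℕ.* k ℕ.* k)) * C
    ≡⟨ cong (λ z → ℕ→ℚ z * C) coefficients ⟩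
  ℕ→ℚ (256 ℕ.* r ℕ.* (m ℕ.* m ℕ.* m ℕ.* m)) * C
    ≡⟨ cong (_* C) (ℕ→ℚ-homo-*-fourth (256 ℕ.* r) m) ⟩
  ℕ→ℚ (256 ℕ.* r) * (M * M * M * M) * C
    ≡⟨ cong (λ z → z * (M * M * M * M) * C) (ℕ→ℚ-homo-* 256 r) ⟩
  ℕ→ℚ 256 * R * (M * M * M * M) * C
    ≡⟨ unfactor R M c e ⟩
  R * ((c * M) * (c * M) * (c * M) * (c * M)) * (v * e) ∎
  where
  open ≡-Reasoning
  A = ℕ→ℚ a
  B = ℕ→ℚ b
  K = ℕ→ℚ k
  R = ℕ→ℚ r
  M = ℕ→ℚ m
  u = (+ 1) ℚ./ 256
  v = (+ 1) ℚ./ 16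
  C = c * c * c * c * (v * (u * e))
  factor : ∀ A B K c e →
    A * (c * c * c * c) * (u * e) + B * ((K * c) * (K * c) * (K * c) * (K * c)) * (v * (u * e))
    ≡ (ℕ→ℚ 16 * A + B * (K * K * K * K)) * (c * c * c * c * (v * (u * e)))
  factor = solve 5 (λ A B K c e →
      A :* (c :* c :* c :* c) :* (con u :* e)
        :+ B :* ((K :* c) :* (K :* c) :* (K :* c) :* (K :* c)) :* (con v :* (con u :* e))
      := (con (ℕ→ℚ 16) :* A :+ B :* (K :* K :* K :* K)) :* (c :* c :* c :* c :* (con v :* (con u :* e))))
    refl
    where open +-*-Solver
  unfactor : ∀ R M c e →
    ℕ→ℚ 256 * R * (M * M * M * M) * (c * c * c * c * (v * (u * e)))
    ≡ R * ((c * M) * (c * M) * (c * M) * (c * M)) * (v * e)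
  unfactor = solve 4 (λ R M c e →
      con (ℕ→ℚ 256) :* R :* (M :* M :* M :* M) :* (c :* c :* c :* c :* (con v :* (con u :* e)))
      := R :* ((c :* M) :* (c :* M) :* (c :* M) :* (c :* M)) :* (con v :* e))
    refl
    where open +-*-Solver

term+remainder[1+n]≡remainder[n] : ∀ n → term (suc n) + remainder (suc n) ≡ remainder n
term+remainder[1+n]≡remainder[n] n = begin
  term (suc n) + remainder (suc n)
    ≡⟨ cong₂ _+_ (cong (A * (c * c * c * c) *_) 1/256^[1+n]) remainder[1+n] ⟩
  A * (c * c * c * c) * (u * e) + B * ((K * c) * (K * c) * (K * c) * (K * c)) * (v * (u * e))
    ≡⟨ remainder-step-algebra a b k r (suc (suc n)) c e (remainderPolynomial-step n) ⟩
  R * ((c * M) * (c * M) * (c * M) * (c * M)) * (v * e)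
    ≡⟨ remainder[n] ⟨
  remainder n ∎
  where
  open ≡-Reasoning
  a = 4 ℕ.* suc n ℕ.+ 3
  b = remainderPolynomial (suc n)
  r = remainderPolynomial n
  k = 2 ℕ.* (2 ℕ.* suc n ℕ.+ 1)
  A = ℕ→ℚ a
  B = ℕ→ℚ b
  R = ℕ→ℚ r
  K = ℕ→ℚ k
  M = ℕ→ℚ (suc (suc n))
  c = catalan (suc n)
  e = ((+ 1) ℚ./ (256 ℕ.^ n)) {{ℕ.m^n≢0 256 n}}
  u = (+ 1) ℚ./ 256
  v = (+ 1) ℚ./ 16
  1/256^[1+n] = 1/[m*n]≡1/m*1/n 256 (256 ℕ.^ n) {{_}} {{ℕ.m^n≢0 256 n}}
  remainder[1+n] : remainder (suc n) ≡ B * ((K * c) * (K * c) * (K * c) * (K * c)) * (v * (u * e))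
  remainder[1+n] = cong₂ _*_
    (trans (ℕ→ℚ-homo-*-fourth b (centralBinomial (suc (suc n))))
           (cong (λ x → B * (x * x * x * x)) (centralBinomial[1+m]≡[4m+2]*catalan (suc n))))
    (trans (1/[m*n]≡1/m*1/n 16 (256 ℕ.^ suc n) {{_}} {{ℕ.m^n≢0 256 (suc n)}}) (cong (v *_) 1/256^[1+n]))
  remainder[n] : remainder n ≡ R * ((c * M) * (c * M) * (c * M) * (c * M)) * (v * e)
  remainder[n] = cong₂ _*_
    (trans (ℕ→ℚ-homo-*-fourth r (centralBinomial (suc n)))
           (cong (λ x → R * (x * x * x * x)) (centralBinomial≡catalan*[1+m] (suc n))))
    (1/[m*n]≡1/m*1/n 16 (256 ℕ.^ n) {{_}} {{ℕ.m^n≢0 256 n}})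

sumTo+remainder≡16 : ∀ n → sumTo n + remainder n ≡ ℕ→ℚ 16
sumTo+remainder≡16 zero    = refl
sumTo+remainder≡16 (suc n) = begin
  sumTo n + term (suc n) + remainder (suc n)
    ≡⟨ +-assoc (sumTo n) (term (suc n)) (remainder (suc n)) ⟩
  sumTo n + (term (suc n) + remainder (suc n))
    ≡⟨ cong (λ x → sumTo n + x) (term+remainder[1+n]≡remainder[n] n) ⟩
  sumTo n + remainder n
    ≡⟨ sumTo+remainder≡16 n ⟩
  ℕ→ℚ 16 ∎
  where open ≡-Reasoning

sumTo-congruence : ∀ {p} n → Prime p → ¬ (p ≡ 2) → p ≡ 1 ℕ.+ 2 ℕ.* n →
                   CongPow p 4 (sumTo n) (ℕ→ℚ 16)
sumTo-congruence {p} n pp p≢2 refl with prime[1+2n]∣centralBinomial[1+n] {n} pp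
... | divides d b≡d*p =
  CongPow-intro {e = 4} {{16*256^n≢0 n}} (odd-prime∤16*256^n pp p≢2 n) {sumTo n}
    (r ℕ.* (d ℕ.* d ℕ.* d ℕ.* d)) (begin
    sumTo n + ℕ→ℚ (p ℕ.^ 4 ℕ.* (r ℕ.* (d ℕ.* d ℕ.* d ℕ.* d))) * w
      ≡⟨ cong (λ x → sumTo n + ℕ→ℚ x * w) (regroup r d p) ⟩
    sumTo n + ℕ→ℚ (r ℕ.* ((d ℕ.* p) ℕ.* (d ℕ.* p) ℕ.* (d ℕ.* p) ℕ.* (d ℕ.* p))) * w
      ≡⟨ cong (λ b → sumTo n + ℕ→ℚ (r ℕ.* (b ℕ.* b ℕ.* b ℕ.* b)) * w) b≡d*p ⟨
    sumTo n + remainder n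
      ≡⟨ sumTo+remainder≡16 n ⟩
    ℕ→ℚ 16 ∎)
  where
  open ≡-Reasoning
  r = remainderPolynomial n
  w = ((+ 1) ℚ./ (16 ℕ.* 256 ℕ.^ n)) {{16*256^n≢0 n}}
  -- p ℕ.^ 4 is written out, since solve-∀ treats ℕ._^_ as opaque.
  regroup : ∀ r d p → p ℕ.* (p ℕ.* (p ℕ.* (p ℕ.* 1))) ℕ.* (r ℕ.* (d ℕ.* d ℕ.* d ℕ.* d))
                    ≡ r ℕ.* ((d ℕ.* p) ℕ.* (d ℕ.* p) ℕ.* (d ℕ.* p) ℕ.* (d ℕ.* p))
  regroup = solve-∀

corollary5p2 : (p : ℕ) → Prime p → ¬ (p ≡ 2) →
    CongPow p 4 (sumTo ((p ∸ 1) / 2)) (ℕ→ℚ 16)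
corollary5p2 p pp p≢2 with odd-prime≡1+2n pp p≢2
... | n , p≡1+2n = subst (λ k → CongPow p 4 (sumTo k) (ℕ→ℚ 16)) (sym [p∸1]/2≡n)
                     (sumTo-congruence n pp p≢2 p≡1+2n)
  where
  [p∸1]/2≡n : (p ∸ 1) / 2 ≡ n
  [p∸1]/2≡n = trans (cong (λ k → (k ∸ 1) / 2) p≡1+2n)
                    (trans (cong (_/ 2) (ℕ.*-comm 2 n)) (m*n/n≡m n 2))
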